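{- Let $N$ be an odd positive integer with $\sigma^*(\sigma^*(N))=2N$ and $N\neq 9,165$, write $N=p_1^{e_1}\cdots p_k^{e_k}$ with distinct primes $p_i$ and $e_i\ge1$, and write $\sigma^*(N)=2^{f_1}q^{f_2}$ with $q$ an odd prime and $f_1,f_2\ge 1$. If $3\nmid N$ and $3\mid\sigma^*(N)$, then $f_1$ and $f_2$ are even, and each $p_i$ has the form $2\cdot 3^{b_i}-1$ with $b_i$ a positive integer.
   Context: $\sigma^*(n)$ is the sum of the unitary divisors of $n$, i.e. divisors $d$ of $n$ with $\gcd(d,n/d)=1$. For odd $N$ with $\sigma^*(\sigma^*(N))=2N$, $\sigma^*(N)$ is always of the form $2^{f_1}q^{f_2}$ with $q$ an odd prime. -}

module Defs where

open import Data.Nat using (ℕ; zero; suc; _+_; _*_; _/_)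
open import Data.Nat.Divisibility using (_∣?_)
open import Data.Nat.GCD using (gcd)
open import Data.Nat.Properties using (_≟_)
open import Data.List using (List; map; upTo)
open import Data.Nat.ListAction using (sum)
open import Relation.Nullary using (does)
open import Data.Bool using (if_then_else_; _∧_)

unitaryTerm : ℕ → ℕ → ℕ
unitaryTerm n i =
  if does (suc i ∣? n) ∧ does (gcd (suc i) (n / suc i) ≟ 1)
  then suc i else 0

σ* : ℕ → ℕ
σ* n = sum (map (unitaryTerm n) (upTo n))

{-# OPTIONS --safe #-}
-- σ* is multiplicative on coprime prime powers: σ* (p ^ e * m) = (1 + p ^ e) σ* m. Since 3 ∤ N
-- but 3 ∣ σ* N = 2 ^ f₁ q ^ f₂, q = 3, and 2 N = σ* (2 ^ f₁ 3 ^ f₂) = (1 + 2 ^ f₁) (1 + 3 ^ f₂).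
-- An odd f₁ would put 3 into 1 + 2 ^ f₁, an odd f₂ would put 4 into 1 + 3 ^ f₂. With both
-- exponents even, a prime p ∣ N divides some x² + 1, hence p ≡ 1 (mod 4) by Fermat's little
-- theorem. For p ^ e the exact power of p in N, 1 + p ^ e divides σ* N and is twice an odd
-- number, so p ^ e + 1 = 2 * 3 ^ b. Congruences modulo 3, and modulo powers of 3 for the
-- expansion of p ^ e + 1 around p + 1 = 2 * 3 ^ c, leave only e = 1.
module Submission where

open import Defs
open import Data.Bool using (if_then_else_; _∧_)
open import Data.Empty using (⊥; ⊥-elim)
open import Data.Fin using (zero; suc)
open import Data.List using (map; upTo; _++_; [_])
open import Data.List.Properties using (map-++; applyUpTo-∷ʳ)
open import Data.Nat
open import Data.Nat.Combinatorics using (_C_; nCn≡1; nC1≡n; nCk+nC[k+1]≡[n+1]C[k+1]; k>n⇒nCk≡0)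
open import Data.Nat.Coprimality as Coprime using (Coprime; coprime-divisor)
open import Data.Nat.Divisibility
open import Data.Nat.DivMod using (m*n/n≡m; DivMod; _divMod_; result)
open import Data.Nat.GCD using (gcd)
open import Data.Nat.Induction using (<-wellFounded)
open import Data.Nat.ListAction using (sum)
open import Data.Nat.ListAction.Properties using (sum-++)
open import Data.Nat.Primality
  using (Prime; prime?; prime[2]; ¬prime[0]; ¬prime[1]; prime⇒irreducible; prime⇒nonZero; prime⇒nonTrivial; euclidsLemma)
open import Data.Nat.Properties
open import Data.Nat.Tactic.RingSolver using (solve-∀)
open import Data.Product using (Σ; _×_; ∃; _,_; proj₁; proj₂)
open import Data.Sum using (_⊎_; inj₁; inj₂; [_,_]′)
open import Data.Unit using (tt)
open import Function using (_∘_; id)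
open import Induction.WellFounded using (Acc; acc)
open import Relation.Binary.PropositionalEquality using (_≡_; _≢_; refl; sym; trans; cong; cong₂; subst; module ≡-Reasoning)
open import Relation.Nullary using (¬_; Dec; yes; no; does)
open import Relation.Nullary.Decidable using (toWitness; decidable-stable)
open import Algebra.Properties.CommutativeSemigroup *-commutativeSemigroup using (x∙yz≈y∙xz)

-- Finite sums

sumBelow : ℕ → (ℕ → ℕ) → ℕ
sumBelow n g = sum (map g (upTo n))

sumBelow-suc : ∀ n g → sumBelow (suc n) g ≡ sumBelow n g + g n
sumBelow-suc n g = begin
  sum (map g (upTo (suc n)))            ≡⟨ cong (sum ∘ map g) (applyUpTo-∷ʳ (λ i → i) n) ⟨
  sum (map g (upTo n ++ [ n ])) ≡⟨ cong sum (map-++ g (upTo n) [ n ]) ⟩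
  sum (map g (upTo n) ++ [ g n ]) ≡⟨ sum-++ (map g (upTo n)) [ g n ] ⟩
  sumBelow n g + (g n + 0)              ≡⟨ cong (sumBelow n g +_) (+-identityʳ (g n)) ⟩
  sumBelow n g + g n                    ∎
  where open ≡-Reasoning

sumBelow-cong : ∀ n {g h} → (∀ {i} → i < n → g i ≡ h i) → sumBelow n g ≡ sumBelow n h
sumBelow-cong zero    g≗h = refl
sumBelow-cong (suc n) {g} {h} g≗h = begin
  sumBelow (suc n) g    ≡⟨ sumBelow-suc n g ⟩
  sumBelow n g + g n    ≡⟨ cong₂ _+_ (sumBelow-cong n (g≗h ∘ m<n⇒m<1+n)) (g≗h ≤-refl) ⟩
  sumBelow n h + h n    ≡⟨ sumBelow-suc n h ⟨
  sumBelow (suc n) h    ∎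
  where open ≡-Reasoning

sumBelow-vanishing : ∀ n {g} → (∀ {i} → i < n → g i ≡ 0) → sumBelow n g ≡ 0
sumBelow-vanishing zero    g≗0 = refl
sumBelow-vanishing (suc n) {g} g≗0 = begin
  sumBelow (suc n) g    ≡⟨ sumBelow-suc n g ⟩
  sumBelow n g + g n    ≡⟨ cong₂ _+_ (sumBelow-vanishing n (g≗0 ∘ m<n⇒m<1+n)) (g≗0 ≤-refl) ⟩
  0                     ∎
  where open ≡-Reasoning

sumBelow-+ : ∀ n g h → sumBelow n (λ i → g i + h i) ≡ sumBelow n g + sumBelow n h
sumBelow-+ zero    g h = refl
sumBelow-+ (suc n) g h = begin
  sumBelow (suc n) (λ i → g i + h i)          ≡⟨ sumBelow-suc n _ ⟩
  sumBelow n (λ i → g i + h i) + (g n + h n)  ≡⟨ cong (_+ (g n + h n)) (sumBelow-+ n g h) ⟩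
  sumBelow n g + sumBelow n h + (g n + h n)   ≡⟨ +-+-comm (sumBelow n g) _ _ _ ⟩
  (sumBelow n g + g n) + (sumBelow n h + h n) ≡⟨ cong₂ _+_ (sumBelow-suc n g) (sumBelow-suc n h) ⟨
  sumBelow (suc n) g + sumBelow (suc n) h     ∎
  where
  open ≡-Reasoning
  +-+-comm : ∀ a b c d → a + b + (c + d) ≡ a + c + (b + d)
  +-+-comm = solve-∀

sumBelow-*ˡ : ∀ n k g → sumBelow n (λ i → k * g i) ≡ k * sumBelow n g
sumBelow-*ˡ zero    k g = sym (*-zeroʳ k)
sumBelow-*ˡ (suc n) k g = begin
  sumBelow (suc n) (λ i → k * g i)   ≡⟨ sumBelow-suc n _ ⟩
  sumBelow n (λ i → k * g i) + k * g n ≡⟨ cong (_+ k * g n) (sumBelow-*ˡ n k g) ⟩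
  k * sumBelow n g + k * g n         ≡⟨ *-distribˡ-+ k _ _ ⟨
  k * (sumBelow n g + g n)           ≡⟨ cong (k *_) (sumBelow-suc n g) ⟨
  k * sumBelow (suc n) g             ∎
  where open ≡-Reasoning

sumBelow-split : ∀ m n g → sumBelow (m + n) g ≡ sumBelow m g + sumBelow n (λ i → g (m + i))
sumBelow-split m zero    g = trans (cong (λ k → sumBelow k g) (+-identityʳ m)) (sym (+-identityʳ _))
sumBelow-split m (suc n) g = begin
  sumBelow (m + suc n) g                                 ≡⟨ cong (λ k → sumBelow k g) (+-suc m n) ⟩
  sumBelow (suc (m + n)) g                               ≡⟨ sumBelow-suc (m + n) g ⟩
  sumBelow (m + n) g + g (m + n)                         ≡⟨ cong (_+ g (m + n)) (sumBelow-split m n g) ⟩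
  sumBelow m g + sumBelow n (λ i → g (m + i)) + g (m + n) ≡⟨ +-assoc (sumBelow m g) _ _ ⟩
  sumBelow m g + (sumBelow n (λ i → g (m + i)) + g (m + n)) ≡⟨ cong (sumBelow m g +_) (sumBelow-suc n _) ⟨
  sumBelow m g + sumBelow (suc n) (λ i → g (m + i))       ∎
  where open ≡-Reasoning

-- Index i stands for the number 1 + i, so the multiples of 1 + k sit at the indices (1 + k) j + k.
sumBelow-multiples : ∀ k m g → (∀ i → ¬ suc k ∣ suc i → g i ≡ 0)
  → sumBelow (suc k * m) g ≡ sumBelow m (λ j → g (suc k * j + k))
sumBelow-multiples k zero    g g≡0 = cong (λ n → sumBelow n g) (*-zeroʳ k)
sumBelow-multiples k (suc m) g g≡0 = begin
  sumBelow (suc k * suc m) g                                  ≡⟨ cong (λ n → sumBelow n g) (*-suc (suc k) m) ⟩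
  sumBelow (suc k + suc k * m) g                              ≡⟨ cong (λ n → sumBelow n g) (+-comm (suc k) _) ⟩
  sumBelow (suc k * m + suc k) g                              ≡⟨ sumBelow-split (suc k * m) (suc k) g ⟩
  sumBelow (suc k * m) g + sumBelow (suc k) (λ i → g (suc k * m + i))
    ≡⟨ cong₂ _+_ (sumBelow-multiples k m g g≡0) (sumBelow-suc k _) ⟩
  sumBelow m (λ j → g (suc k * j + k)) + (sumBelow k (λ i → g (suc k * m + i)) + g (suc k * m + k))
    ≡⟨ cong (λ s → sumBelow m (λ j → g (suc k * j + k)) + (s + g (suc k * m + k))) (sumBelow-vanishing k below-next-multiple) ⟩
  sumBelow m (λ j → g (suc k * j + k)) + g (suc k * m + k)   ≡⟨ sumBelow-suc m _ ⟨
  sumBelow (suc m) (λ j → g (suc k * j + k))                  ∎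
  where
  open ≡-Reasoning
  below-next-multiple : ∀ {i} → i < k → g (suc k * m + i) ≡ 0
  below-next-multiple {i} i<k = g≡0 _ λ k+1∣ → <⇒≱ (s≤s i<k)
    (∣⇒≤ (∣m+n∣m⇒∣n (subst (suc k ∣_) (sym (+-suc (suc k * m) i)) k+1∣) (m∣m*n m)))

∣-sumBelow : ∀ d n g → (∀ {i} → i < n → d ∣ g i) → d ∣ sumBelow n g
∣-sumBelow d zero    g d∣g = d ∣0
∣-sumBelow d (suc n) g d∣g = subst (d ∣_) (sym (sumBelow-suc n g))
  (∣m∣n⇒∣m+n (∣-sumBelow d n g (d∣g ∘ m<n⇒m<1+n)) (d∣g ≤-refl))

-- Divisibility, coprimality and primes

∤r+ad : ∀ {d r} a → 0 < r → r < d → ¬ d ∣ r + a * d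
∤r+ad {d} {r} a 0<r r<d d∣r+ad = <⇒≱ r<d (∣⇒≤ {{>-nonZero 0<r}} (∣m+n∣m⇒∣n (subst (d ∣_) (+-comm r (a * d)) d∣r+ad) (n∣m*n a)))

coprime-∣ˡ : ∀ {a b d} → Coprime a b → d ∣ a → Coprime d b
coprime-∣ˡ a⊥b d∣a (i∣d , i∣b) = a⊥b (∣-trans i∣d d∣a , i∣b)

coprime-*ʳ : ∀ {d a b} → Coprime d a → Coprime d b → Coprime d (a * b)
coprime-*ʳ d⊥a d⊥b (i∣d , i∣ab) = d⊥b (i∣d , coprime-divisor (coprime-∣ˡ d⊥a i∣d) i∣ab)

coprime-*ʳ⁻ : ∀ {d} a {b} → Coprime d (a * b) → Coprime d b
coprime-*ʳ⁻ a d⊥ab (i∣d , i∣b) = d⊥ab (i∣d , ∣n⇒∣m*n a i∣b)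

coprime-^ʳ : ∀ {d a} n → Coprime d a → Coprime d (a ^ n)
coprime-^ʳ zero    d⊥a = Coprime.sym (Coprime.1-coprimeTo _)
coprime-^ʳ (suc n) d⊥a = coprime-*ʳ d⊥a (coprime-^ʳ n d⊥a)

prime⇒≢1 : ∀ {p} → Prime p → p ≢ 1
prime⇒≢1 p-prime refl = ¬prime[1] p-prime

prime∤⇒coprime : ∀ {p n} → Prime p → ¬ p ∣ n → Coprime p n
prime∤⇒coprime p-prime p∤n (i∣p , i∣n) with prime⇒irreducible p-prime i∣p
... | inj₁ i≡1 = i≡1
... | inj₂ refl = ⊥-elim (p∤n i∣n)

prime[3] : Prime 3
prime[3] = toWitness {a? = prime? 3} tt

prime∣^⇒∣ : ∀ {p a} n → Prime p → p ∣ a ^ n → p ∣ a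
prime∣^⇒∣ zero    p-prime p∣1 = ⊥-elim (prime⇒≢1 p-prime (∣1⇒≡1 p∣1))
prime∣^⇒∣ {a = a} (suc n) p-prime p∣a^[1+n] =
  [ id , prime∣^⇒∣ n p-prime ]′ (euclidsLemma a (a ^ n) p-prime p∣a^[1+n])

∣prime^⇒≡prime^ : ∀ {q d} n → Prime q → d ∣ q ^ n → ∃ λ c → d ≡ q ^ c
∣prime^⇒≡prime^ zero    q-prime d∣1 = 0 , ∣1⇒≡1 d∣1
∣prime^⇒≡prime^ {q} {d} (suc n) q-prime d∣q^[1+n] with q ∣? d
... | no  q∤d = ∣prime^⇒≡prime^ n q-prime (coprime-divisor (Coprime.sym (prime∤⇒coprime q-prime q∤d)) d∣q^[1+n])
... | yes (divides d′ d≡d′q) with ∣prime^⇒≡prime^ n q-prime d′∣q^n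
  where
  d′∣q^n : d′ ∣ q ^ n
  d′∣q^n = *-cancelˡ-∣ q {{prime⇒nonZero q-prime}} (subst (_∣ q ^ suc n) (trans d≡d′q (*-comm d′ q)) d∣q^[1+n])
...   | c , d′≡q^c = suc c , trans d≡d′q (trans (*-comm d′ q) (cong (q *_) d′≡q^c))

m^n∣m^[n+o] : ∀ m n o → m ^ n ∣ m ^ (n + o)
m^n∣m^[n+o] m n o = divides (m ^ o) (trans (^-distribˡ-+-* m n o) (*-comm (m ^ n) (m ^ o)))

factor-out : ∀ {p} → Prime p → ∀ n → .{{NonZero n}} → ∃ λ e → ∃ λ m → n ≡ p ^ e * m × ¬ p ∣ m
factor-out {p} p-prime n = go n (<-wellFounded n)
  where
  go : ∀ n → .{{NonZero n}} → Acc _<_ n → ∃ λ e → ∃ λ m → n ≡ p ^ e * m × ¬ p ∣ m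
  go n (acc smaller) with p ∣? n
  ... | no  p∤n = 0 , n , sym (+-identityʳ n) , p∤n
  ... | yes (divides n′ n≡n′p) with go n′ {{n′≢0}} (smaller n′<n)
    where
    n′≢0 : NonZero n′
    n′≢0 = ≢-nonZero λ { refl → ≢-nonZero⁻¹ n n≡n′p }
    n′<n : n′ < n
    n′<n = subst (n′ <_) (sym n≡n′p) (m<m*n n′ p {{n′≢0}} (nonTrivial⇒n>1 p {{prime⇒nonTrivial p-prime}}))
  ...   | e , m , n′≡p^em , p∤m = suc e , m , trans n≡n′p (trans (cong (_* p) n′≡p^em) (regroup (p ^ e) m p)) , p∤m
    where
    regroup : ∀ a m p → a * m * p ≡ p * a * m
    regroup = solve-∀

odd⇒≡1+2q : ∀ {n} → ¬ 2 ∣ n → ∃ λ q → n ≡ 1 + q * 2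
odd⇒≡1+2q {n} 2∤n with n divMod 2
... | result q zero       n≡2q   = ⊥-elim (2∤n (divides q n≡2q))
... | result q (suc zero) n≡1+2q = q , n≡1+2q

^≡1[mod] : ∀ m t n → ∃ λ s → (1 + t * m) ^ n ≡ 1 + s * m
^≡1[mod] m t zero    = 0 , refl
^≡1[mod] m t (suc n) with ^≡1[mod] m t n
... | s , eq = t + s + t * m * s , trans (cong ((1 + t * m) *_) eq) (expand m t s)
  where
  expand : ∀ m t s → (1 + t * m) * (1 + s * m) ≡ 1 + (t + s + t * m * s) * m
  expand = solve-∀

-- Unitary divisors and the multiplicativity of σ*

infix 4 _∥_

_∥_ : ℕ → ℕ → Set
d ∥ n = ∃ λ c → n ≡ d * c × Coprime d c

unitaryTerm-view : ∀ n i → (suc i ∥ n × unitaryTerm n i ≡ suc i) ⊎ (¬ suc i ∥ n × unitaryTerm n i ≡ 0)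
unitaryTerm-view n i = view (suc i ∣? n) (gcd (suc i) (n / suc i) ≟ 1)
  where
  d = suc i
  n/d≡ : ∀ {c} → n ≡ d * c → n / d ≡ c
  n/d≡ {c} n≡dc = trans (cong (_/ d) (trans n≡dc (*-comm d c))) (m*n/n≡m c d)
  view : (d∣n? : Dec (d ∣ n)) (gcd≡1? : Dec (gcd d (n / d) ≡ 1))
    → let t = if does d∣n? ∧ does gcd≡1? then d else 0 in (d ∥ n × t ≡ d) ⊎ (¬ d ∥ n × t ≡ 0)
  view (no ¬d∣n) _ = inj₂ ((λ (c , n≡dc , _) → ¬d∣n (divides c (trans n≡dc (*-comm d c)))) , refl)
  view (yes (divides c n≡cd)) (yes gcd≡1) =
    inj₁ ((c , n≡dc , subst (Coprime d) (n/d≡ n≡dc) (Coprime.gcd≡1⇒coprime gcd≡1)) , refl)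
    where n≡dc = trans n≡cd (*-comm c d)
  view (yes _) (no gcd≢1) = inj₂ ((λ (c , n≡dc , coprime) →
    gcd≢1 (subst (λ x → gcd d x ≡ 1) (sym (n/d≡ n≡dc)) (Coprime.coprime⇒gcd≡1 coprime))) , refl)

unitaryTerm-∥ : ∀ {n i} → suc i ∥ n → unitaryTerm n i ≡ suc i
unitaryTerm-∥ {n} {i} d∥n with unitaryTerm-view n i
... | inj₁ (_ , t≡d)  = t≡d
... | inj₂ (d∦n , _) = ⊥-elim (d∦n d∥n)

unitaryTerm-∦ : ∀ {n i} → ¬ suc i ∥ n → unitaryTerm n i ≡ 0
unitaryTerm-∦ {n} {i} d∦n with unitaryTerm-view n i
... | inj₁ (d∥n , _) = ⊥-elim (d∦n d∥n)
... | inj₂ (_ , t≡0) = t≡0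

unitaryTerm-scale : ∀ {n m i j} k → suc i ≡ k * suc j
  → (suc i ∥ n → suc j ∥ m) → (suc j ∥ m → suc i ∥ n) → unitaryTerm n i ≡ k * unitaryTerm m j
unitaryTerm-scale {n} {m} {i} {j} k i≡kj to from with unitaryTerm-view m j
... | inj₁ (j∥m , t≡j) = trans (unitaryTerm-∥ (from j∥m)) (trans i≡kj (cong (k *_) (sym t≡j)))
... | inj₂ (j∦m , t≡0) = trans (unitaryTerm-∦ (j∦m ∘ to)) (trans (sym (*-zeroʳ k)) (cong (k *_) (sym t≡0)))

unitaryTerm-cong : ∀ {n m i} → (suc i ∥ n → suc i ∥ m) → (suc i ∥ m → suc i ∥ n) → unitaryTerm n i ≡ unitaryTerm m i
unitaryTerm-cong {n} {m} {i} to from =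
  trans (unitaryTerm-scale 1 (sym (*-identityˡ (suc i))) to from) (*-identityˡ (unitaryTerm m i))

∥⇒≤ : ∀ {d n} → .{{NonZero n}} → d ∥ n → d ≤ n
∥⇒≤ {d} (c , n≡dc , _) = ∣⇒≤ (divides c (trans n≡dc (*-comm d c)))

σ*-sumBelow : ∀ n .{{_ : NonZero n}} k → σ* n ≡ sumBelow (n + k) (unitaryTerm n)
σ*-sumBelow n k = sym (begin
  sumBelow (n + k) (unitaryTerm n)                           ≡⟨ sumBelow-split n k _ ⟩
  σ* n + sumBelow k (λ i → unitaryTerm n (n + i))            ≡⟨ cong (σ* n +_) (sumBelow-vanishing k beyond-n) ⟩
  σ* n + 0                                                   ≡⟨ +-identityʳ (σ* n) ⟩
  σ* n                                                       ∎)
  where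
  open ≡-Reasoning
  beyond-n : ∀ {i} → i < k → unitaryTerm n (n + i) ≡ 0
  beyond-n {i} _ = unitaryTerm-∦ λ d∥n → <⇒≱ (s≤s (m≤m+n n i)) (∥⇒≤ d∥n)

-- K = 1 + k stands for a power of p (via coprime-K and p∣K). The unitary divisors of K m
-- prime to p are those of m; the others are the K d with d ∥ m.
module PrimePowerFactor {p} (p-prime : Prime p) (k : ℕ)
  (coprime-K : ∀ {x} → ¬ p ∣ x → Coprime x (suc k)) (p∣K : p ∣ suc k)
  {m} (p∤m : ¬ p ∣ m) where

  K : ℕ
  K = suc k

  ∥-cancel : ∀ {d} → ¬ p ∣ d → d ∥ K * m → d ∥ m
  ∥-cancel {d} p∤d (c , Km≡dc , d⊥c) with coprime-divisor (coprime-K p∤d) (divides c (trans Km≡dc (*-comm d c)))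
  ... | divides c′ m≡c′d = c′ , m≡dc′ , coprime-*ʳ⁻ K (subst (Coprime d) c≡Kc′ d⊥c)
    where
    m≡dc′ : m ≡ d * c′
    m≡dc′ = trans m≡c′d (*-comm c′ d)
    d≢0 : NonZero d
    d≢0 = ≢-nonZero λ { refl → p∤d (p ∣0) }
    c≡Kc′ : c ≡ K * c′
    c≡Kc′ = *-cancelˡ-≡ c (K * c′) d {{d≢0}} (begin
      d * c          ≡⟨ Km≡dc ⟨
      K * m          ≡⟨ cong (K *_) m≡dc′ ⟩
      K * (d * c′)   ≡⟨ x∙yz≈y∙xz K d c′ ⟩
      d * (K * c′)   ∎)
      where open ≡-Reasoning

  ∥-extend : ∀ {d} → ¬ p ∣ d → d ∥ m → d ∥ K * m
  ∥-extend {d} p∤d (c , m≡dc , d⊥c) =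
    K * c , trans (cong (K *_) m≡dc) (x∙yz≈y∙xz K d c) , coprime-*ʳ (coprime-K p∤d) d⊥c

  p∣d⇒∦m : ∀ {d} → p ∣ d → ¬ d ∥ m
  p∣d⇒∦m p∣d (c , m≡dc , _) = p∤m (subst (p ∣_) (sym m≡dc) (∣m⇒∣m*n c p∣d))

  p∣d∥Km⇒K∣d : ∀ {d} → p ∣ d → d ∥ K * m → K ∣ d
  p∣d∥Km⇒K∣d {d} p∣d (c , Km≡dc , d⊥c) =
    coprime-divisor (Coprime.sym (coprime-K p∤c)) (subst (K ∣_) (trans Km≡dc (*-comm d c)) (m∣m*n m))
    where
    p∤c : ¬ p ∣ c
    p∤c p∣c = prime⇒≢1 p-prime (d⊥c (p∣d , p∣c))

  ∥⇒*∥* : ∀ {d} → d ∥ m → K * d ∥ K * m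
  ∥⇒*∥* {d} (c , m≡dc , d⊥c) =
    c , trans (cong (K *_) m≡dc) (sym (*-assoc K d c)) , Coprime.sym (coprime-*ʳ (coprime-K p∤c) (Coprime.sym d⊥c))
    where
    p∤c : ¬ p ∣ c
    p∤c p∣c = p∤m (subst (p ∣_) (sym m≡dc) (∣n⇒∣m*n d p∣c))

  *∥*⇒∥ : ∀ {d} → K * d ∥ K * m → d ∥ m
  *∥*⇒∥ {d} (c , Km≡Kdc , Kd⊥c) =
    c , *-cancelˡ-≡ m (d * c) K (trans Km≡Kdc (*-assoc K d c)) , coprime-∣ˡ Kd⊥c (n∣m*n K)

  N : ℕ
  N = K * m

  pPart : ℕ → ℕ
  pPart i = if does (p ∣? suc i) then unitaryTerm N i else 0

  unitaryTerm-split : ∀ i → unitaryTerm N i ≡ unitaryTerm m i + pPart i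
  unitaryTerm-split i with p ∣? suc i
  ... | yes p∣d = sym (cong (_+ unitaryTerm N i) (unitaryTerm-∦ (p∣d⇒∦m p∣d)))
  ... | no  p∤d = trans (unitaryTerm-cong (∥-cancel p∤d) (∥-extend p∤d)) (sym (+-identityʳ _))

  pPart-vanishing : ∀ i → ¬ K ∣ suc i → pPart i ≡ 0
  pPart-vanishing i K∤d with p ∣? suc i
  ... | yes p∣d = unitaryTerm-∦ (K∤d ∘ p∣d∥Km⇒K∣d p∣d)
  ... | no  _   = refl

  1+[Kj+k]≡K[1+j] : ∀ j → suc (K * j + k) ≡ K * suc j
  1+[Kj+k]≡K[1+j] j = trans (cong suc (+-comm (K * j) k)) (sym (*-suc K j))

  pPart-multiple : ∀ j → pPart (K * j + k) ≡ K * unitaryTerm m j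
  pPart-multiple j with p ∣? suc (K * j + k)
  ... | yes _   = unitaryTerm-scale K (1+[Kj+k]≡K[1+j] j)
    (*∥*⇒∥ ∘ subst (_∥ N) (1+[Kj+k]≡K[1+j] j)) (subst (_∥ N) (sym (1+[Kj+k]≡K[1+j] j)) ∘ ∥⇒*∥*)
  ... | no  p∤d = ⊥-elim (p∤d (subst (p ∣_) (sym (1+[Kj+k]≡K[1+j] j)) (∣m⇒∣m*n (suc j) p∣K)))

  σ*-*K : σ* (K * m) ≡ (1 + K) * σ* m
  σ*-*K = begin
    σ* N                                              ≡⟨ sumBelow-cong N (λ {i} _ → unitaryTerm-split i) ⟩
    sumBelow N (λ i → unitaryTerm m i + pPart i)      ≡⟨ sumBelow-+ N (unitaryTerm m) pPart ⟩
    sumBelow (m + k * m) (unitaryTerm m) + sumBelow N pPart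
      ≡⟨ cong₂ _+_ (sym (σ*-sumBelow m {{m≢0}} (k * m))) (sumBelow-multiples k m pPart pPart-vanishing) ⟩
    σ* m + sumBelow m (λ j → pPart (K * j + k))       ≡⟨ cong (σ* m +_) (sumBelow-cong m (λ {j} _ → pPart-multiple j)) ⟩
    σ* m + sumBelow m (λ j → K * unitaryTerm m j)     ≡⟨ cong (σ* m +_) (sumBelow-*ˡ m K (unitaryTerm m)) ⟩
    σ* m + K * σ* m                                   ∎
    where
    open ≡-Reasoning
    m≢0 : NonZero m
    m≢0 = ≢-nonZero λ { refl → p∤m (p ∣0) }

σ*-*primePower : ∀ {p m} e → Prime p → ¬ p ∣ m → σ* (p ^ suc e * m) ≡ (1 + p ^ suc e) * σ* m
σ*-*primePower {p} e p-prime p∤m with p ^ suc e in p^[1+e]≡K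
... | zero  = ⊥-elim (≢-nonZero⁻¹ _ {{m^n≢0 p (suc e) {{prime⇒nonZero p-prime}}}} p^[1+e]≡K)
... | suc k = PrimePowerFactor.σ*-*K p-prime k coprime-K p∣K p∤m
  where
  coprime-K : ∀ {x} → ¬ p ∣ x → Coprime x (suc k)
  coprime-K p∤x = subst (Coprime _) p^[1+e]≡K (coprime-^ʳ (suc e) (Coprime.sym (prime∤⇒coprime p-prime p∤x)))
  p∣K : p ∣ suc k
  p∣K = subst (p ∣_) p^[1+e]≡K (m∣m*n (p ^ e))

1+p^[1+e]∣σ* : ∀ {p N} → .{{NonZero N}} → Prime p → p ∣ N → ∃ λ e → 1 + p ^ suc e ∣ σ* N
1+p^[1+e]∣σ* {p} {N} p-prime p∣N with factor-out p-prime N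
... | zero  , m , N≡m , p∤m = ⊥-elim (p∤m (subst (p ∣_) (trans N≡m (*-identityˡ m)) p∣N))
... | suc e , m , N≡p^[1+e]m , p∤m =
  e , divides (σ* m) (trans (cong σ* N≡p^[1+e]m) (trans (σ*-*primePower e p-prime p∤m) (*-comm _ (σ* m))))

-- Fermat's little theorem and primes dividing x² + 1

C-absorption : ∀ n k → suc k * (suc n C suc k) ≡ suc n * (n C k)
C-absorption zero    zero    = refl
C-absorption zero    (suc k) = *-zeroʳ (2 + k)
C-absorption (suc n) zero    = trans (+-identityʳ _) (trans (nC1≡n (2 + n)) (sym (*-identityʳ (2 + n))))
C-absorption (suc n) (suc k) = begin
  suc (suc k) * (suc (suc n) C suc (suc k))
    ≡⟨ cong (suc (suc k) *_) (nCk+nC[k+1]≡[n+1]C[k+1] (suc n) (suc k)) ⟨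
  suc (suc k) * (suc n C suc k + suc n C suc (suc k))
    ≡⟨ expand (suc k) (suc n C suc k) (suc n C suc (suc k)) ⟩
  suc k * (suc n C suc k) + suc n C suc k + suc (suc k) * (suc n C suc (suc k))
    ≡⟨ cong₂ (λ x y → x + suc n C suc k + y) (C-absorption n k) (C-absorption n (suc k)) ⟩
  suc n * (n C k) + suc n C suc k + suc n * (n C suc k)
    ≡⟨ cong (λ x → suc n * (n C k) + x + suc n * (n C suc k)) (nCk+nC[k+1]≡[n+1]C[k+1] n k) ⟨
  suc n * (n C k) + (n C k + n C suc k) + suc n * (n C suc k)
    ≡⟨ collect n (n C k) (n C suc k) ⟩
  suc (suc n) * (n C k + n C suc k)
    ≡⟨ cong (suc (suc n) *_) (nCk+nC[k+1]≡[n+1]C[k+1] n k) ⟩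
  suc (suc n) * (suc n C suc k) ∎
  where
  open ≡-Reasoning
  expand : ∀ k x y → suc k * (x + y) ≡ k * x + x + suc k * y
  expand = solve-∀
  collect : ∀ n x y → suc n * x + (x + y) + suc n * y ≡ suc (suc n) * (x + y)
  collect = solve-∀

prime∣pCk : ∀ {p k} → Prime p → 0 < k → k < p → p ∣ p C k
prime∣pCk {suc n} {suc k} p-prime _ k<p
  with euclidsLemma (suc k) (suc n C suc k) p-prime (divides (n C k) (trans (C-absorption n k) (*-comm (suc n) (n C k))))
... | inj₁ p∣k = ⊥-elim (<⇒≱ k<p (∣⇒≤ p∣k))
... | inj₂ p∣C = p∣C

binomialTerm : ℕ → ℕ → ℕ → ℕ
binomialTerm a n k = (n C k) * a ^ k

binomialTerm-pascal : ∀ a n m →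
  sumBelow (suc m) (binomialTerm a (suc n)) ≡ sumBelow (suc m) (binomialTerm a n) + a * sumBelow m (binomialTerm a n)
binomialTerm-pascal a n zero    = sym (cong (1 +_) (*-zeroʳ a))
binomialTerm-pascal a n (suc m) = begin
  sumBelow (suc (suc m)) (binomialTerm a (suc n))
    ≡⟨ sumBelow-suc (suc m) (binomialTerm a (suc n)) ⟩
  sumBelow (suc m) (binomialTerm a (suc n)) + (suc n C suc m) * (a * a ^ m)
    ≡⟨ cong₂ (λ s c → s + c * (a * a ^ m)) (sym (binomialTerm-pascal a n m)) (nCk+nC[k+1]≡[n+1]C[k+1] n m) ⟨
  S + a * s + (n C m + n C suc m) * (a * a ^ m)
    ≡⟨ regroup S s (n C m) (n C suc m) a (a ^ m) ⟩
  S + (n C suc m) * (a * a ^ m) + a * (s + (n C m) * a ^ m)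
    ≡⟨ cong₂ (λ x y → x + a * y) (sumBelow-suc (suc m) (binomialTerm a n)) (sumBelow-suc m (binomialTerm a n)) ⟨
  sumBelow (suc (suc m)) (binomialTerm a n) + a * sumBelow (suc m) (binomialTerm a n) ∎
  where
  open ≡-Reasoning
  S s : ℕ
  S = sumBelow (suc m) (binomialTerm a n)
  s = sumBelow m (binomialTerm a n)
  regroup : ∀ S s c c′ a w → S + a * s + (c + c′) * (a * w) ≡ S + c′ * (a * w) + a * (s + c * w)
  regroup = solve-∀

binomial-theorem : ∀ a n → (1 + a) ^ n ≡ sumBelow (suc n) (binomialTerm a n)
binomial-theorem a zero    = refl
binomial-theorem a (suc n) = begin
  (1 + a) * (1 + a) ^ n                                     ≡⟨ cong ((1 + a) *_) (binomial-theorem a n) ⟩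
  (1 + a) * S                                               ≡⟨ expand S a ⟩
  S + 0 + a * S                                             ≡⟨ cong (λ c → S + c + a * S) top-term≡0 ⟨
  S + binomialTerm a n (suc n) + a * S                      ≡⟨ cong (_+ a * S) (sumBelow-suc (suc n) (binomialTerm a n)) ⟨
  sumBelow (suc (suc n)) (binomialTerm a n) + a * S         ≡⟨ binomialTerm-pascal a n (suc n) ⟨
  sumBelow (suc (suc n)) (binomialTerm a (suc n))           ∎
  where
  open ≡-Reasoning
  S : ℕ
  S = sumBelow (suc n) (binomialTerm a n)
  top-term≡0 : binomialTerm a n (suc n) ≡ 0
  top-term≡0 = cong (_* a ^ suc n) (k>n⇒nCk≡0 (n<1+n n))
  expand : ∀ S a → (1 + a) * S ≡ S + 0 + a * S
  expand = solve-∀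

fermat-little : ∀ {p} → Prime p → ∀ a → ∃ λ X → a ^ p ≡ a + p * X
fermat-little {zero} p-prime a = ⊥-elim (¬prime[0] p-prime)
fermat-little {p@(suc n)} p-prime zero = 0 , sym (*-zeroʳ p)
fermat-little {p@(suc n)} p-prime (suc a) with fermat-little p-prime a
... | X , a^p≡a+pX with ∣-sumBelow p n (λ i → binomialTerm a p (1 + i)) p∣middle
  where
  p∣middle : ∀ {i} → i < n → p ∣ binomialTerm a p (1 + i)
  p∣middle i<n = ∣m⇒∣m*n _ (prime∣pCk p-prime z<s (s≤s i<n))
... | divides D middle≡Dp = X + D , (begin
  (1 + a) ^ p
    ≡⟨ binomial-theorem a p ⟩
  sumBelow (2 + n) (binomialTerm a p)
    ≡⟨ sumBelow-suc (1 + n) (binomialTerm a p) ⟩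
  sumBelow (1 + n) (binomialTerm a p) + (p C p) * a ^ p
    ≡⟨ cong (_+ (p C p) * a ^ p) (sumBelow-split 1 n (binomialTerm a p)) ⟩
  1 + sumBelow n (λ i → binomialTerm a p (1 + i)) + (p C p) * a ^ p
    ≡⟨ cong₂ (λ s c → 1 + s + c * a ^ p) middle≡Dp (nCn≡1 p) ⟩
  1 + D * p + 1 * a ^ p
    ≡⟨ cong (λ x → 1 + D * p + 1 * x) a^p≡a+pX ⟩
  1 + D * p + 1 * (a + p * X)
    ≡⟨ regroup D p a X ⟩
  suc a + p * (X + D) ∎)
  where
  open ≡-Reasoning
  regroup : ∀ D p a X → 1 + D * p + 1 * (a + p * X) ≡ suc a + p * (X + D)
  regroup = solve-∀

y+1∣y^[1+2q]+1 : ∀ y q → y + 1 ∣ y ^ (1 + q * 2) + 1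
y+1∣y^[1+2q]+1 y zero    = divides 1 (solve y)
  where
  solve : ∀ y → y * 1 + 1 ≡ 1 * (y + 1)
  solve = solve-∀
y+1∣y^[1+2q]+1 y (suc q) = ∣m+n∣m⇒∣n
  (subst (y + 1 ∣_) (shift y (y ^ (q * 2))) (∣m∣n⇒∣m+n (∣n⇒∣m*n (y * y) (y+1∣y^[1+2q]+1 y q)) ∣-refl))
  (n∣m*n y)
  where
  shift : ∀ y w → y * y * (y * w + 1) + (y + 1) ≡ y * (y + 1) + (y * (y * (y * w)) + 1)
  shift = solve-∀

y+1∣1+y^odd : ∀ y {n} → ¬ 2 ∣ n → y + 1 ∣ 1 + y ^ n
y+1∣1+y^odd y 2∤n with odd⇒≡1+2q 2∤n
... | r , refl = subst (y + 1 ∣_) (+-comm (y ^ (1 + r * 2)) 1) (y+1∣y^[1+2q]+1 y r)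

-- By Fermat, x ^ p ≡ x while x ^ p = x * (x²) ^ (2k + 1) ≡ - x modulo p, so p ∣ 2 x.
prime≡3[mod4]⇒∤x²+1 : ∀ {p x} k → Prime p → p ≡ 3 + k * 4 → ¬ p ∣ x * x + 1
prime≡3[mod4]⇒∤x²+1 {p} {x} k p-prime p≡3+4k p∣x²+1 with fermat-little p-prime x
... | X , x^p≡x+pX = <⇒≱ 3≤p (∣⇒≤ (p∣2 ((x * x) ^ (1 + k * 2)) (trans (sym x^p≡xy) x^p≡x+pX) p∣y+1))
  where
  3≤p : 3 ≤ p
  3≤p = subst (3 ≤_) (sym p≡3+4k) (m≤m+n 3 (k * 4))
  p∤x : ¬ p ∣ x
  p∤x p∣x = prime⇒≢1 p-prime (∣1⇒≡1 (∣m+n∣m⇒∣n p∣x²+1 (∣m⇒∣m*n x p∣x)))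
  p∣y+1 : p ∣ (x * x) ^ (1 + k * 2) + 1
  p∣y+1 = ∣-trans p∣x²+1 (y+1∣y^[1+2q]+1 (x * x) k)
  x^p≡xy : x ^ p ≡ x * (x * x) ^ (1 + k * 2)
  x^p≡xy = begin
    x ^ p                     ≡⟨ cong (x ^_) (trans p≡3+4k (exponent k)) ⟩
    x ^ (1 + 2 * (1 + k * 2)) ≡⟨ cong (x *_) (^-*-assoc x 2 (1 + k * 2)) ⟨
    x * (x ^ 2) ^ (1 + k * 2) ≡⟨ cong (λ z → x * (x * z) ^ (1 + k * 2)) (*-identityʳ x) ⟩
    x * (x * x) ^ (1 + k * 2) ∎
    where
    open ≡-Reasoning
    exponent : ∀ k → 3 + k * 4 ≡ 1 + 2 * (1 + k * 2)
    exponent = solve-∀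
  p∣2 : ∀ y → x * y ≡ x + p * X → p ∣ y + 1 → p ∣ 2
  p∣2 zero     x0≡x+pX _ = ⊥-elim (p∤x (subst (p ∣_) (sym x≡0) (p ∣0)))
    where
    x≡0 : x ≡ 0
    x≡0 = m+n≡0⇒m≡0 x (sym (trans (sym (*-zeroʳ x)) x0≡x+pX))
  p∣2 (suc y′) xy≡x+pX p∣y+1 = ∣m+n∣m⇒∣n (subst (p ∣_) (sym (+-suc y′ 1)) p∣y+1) p∣y′
    where
    p∣xy′ : p ∣ x * y′
    p∣xy′ = divides X (trans (+-cancelˡ-≡ x _ _ (trans (sym (*-suc x y′)) xy≡x+pX)) (*-comm p X))
    p∣y′ : p ∣ y′
    p∣y′ = [ ⊥-elim ∘ p∤x , id ]′ (euclidsLemma x y′ p-prime p∣xy′)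

prime∣x²+1⇒≡1[mod4] : ∀ {p x} → Prime p → ¬ 2 ∣ p → p ∣ x * x + 1 → ∃ λ k → p ≡ 1 + k * 4
prime∣x²+1⇒≡1[mod4] {p} {x} p-prime 2∤p p∣x²+1 with p divMod 4
... | result k zero                   p≡4k   = ⊥-elim (2∤p (divides (k * 2) (trans p≡4k (regroup k))))
  where
  regroup : ∀ k → k * 4 ≡ k * 2 * 2
  regroup = solve-∀
... | result k (suc zero)             p≡1+4k = k , p≡1+4k
... | result k (suc (suc zero))       p≡2+4k = ⊥-elim (2∤p (divides (1 + k * 2) (trans p≡2+4k (regroup k))))
  where
  regroup : ∀ k → 2 + k * 4 ≡ (1 + k * 2) * 2
  regroup = solve-∀
... | result k (suc (suc (suc zero))) p≡3+4k = ⊥-elim (prime≡3[mod4]⇒∤x²+1 {x = x} k p-prime p≡3+4k p∣x²+1)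

1+x^[2a]≡x^a*x^a+1 : ∀ x a → 1 + x ^ (a * 2) ≡ x ^ a * x ^ a + 1
1+x^[2a]≡x^a*x^a+1 x a = begin
  1 + x ^ (a * 2)          ≡⟨ cong (1 +_) (^-*-assoc x a 2) ⟨
  1 + (x ^ a) ^ 2          ≡⟨ cong (λ y → 1 + x ^ a * y) (*-identityʳ (x ^ a)) ⟩
  1 + x ^ a * x ^ a        ≡⟨ +-comm 1 _ ⟩
  x ^ a * x ^ a + 1        ∎
  where open ≡-Reasoning

prime∣[1+x^2a][1+y^2b]⇒∣z²+1 : ∀ {p} x y a b → Prime p → p ∣ (1 + x ^ (a * 2)) * (1 + y ^ (b * 2)) → ∃ λ z → p ∣ z * z + 1
prime∣[1+x^2a][1+y^2b]⇒∣z²+1 {p} x y a b p-prime p∣ with euclidsLemma (1 + x ^ (a * 2)) (1 + y ^ (b * 2)) p-prime p∣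
... | inj₁ p∣1+x^2a = x ^ a , subst (p ∣_) (1+x^[2a]≡x^a*x^a+1 x a) p∣1+x^2a
... | inj₂ p∣1+y^2b = y ^ b , subst (p ∣_) (1+x^[2a]≡x^a*x^a+1 y b) p∣1+y^2b

-- The equation p ^ e + 1 = 2 * 3 ^ b

-- For y = 2 + s this says y ^ E + 1 ≡ E (y + 1) modulo (y + 1)², for odd E.
odd-power-expansion : ∀ s r → ∃ λ Z → (2 + s) ^ (1 + r * 2) + 1 ≡ (1 + r * 2) * (3 + s) + (3 + s) * (3 + s) * Z
odd-power-expansion s zero    = 0 , base s
  where
  base : ∀ s → (2 + s) * 1 + 1 ≡ 1 * (3 + s) + (3 + s) * (3 + s) * 0
  base = solve-∀
odd-power-expansion s (suc r) with odd-power-expansion s r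
... | Z , IH = (2 + s) * (2 + s) * Z + (1 + r * 2) * s + r * 2 , +-cancelʳ-≡ (y * y) _ _ (begin
  y * (y * (y * v)) + 1 + y * y
    ≡⟨ factor y v ⟩
  y * y * (y * v + 1) + 1
    ≡⟨ cong (λ z → y * y * z + 1) IH ⟩
  y * y * ((1 + r * 2) * (3 + s) + (3 + s) * (3 + s) * Z) + 1
    ≡⟨ regroup s r Z ⟩
  (1 + suc r * 2) * (3 + s) + (3 + s) * (3 + s) * ((2 + s) * (2 + s) * Z + (1 + r * 2) * s + r * 2) + y * y ∎)
  where
  open ≡-Reasoning
  y v : ℕ
  y = 2 + s
  v = y ^ (r * 2)
  factor : ∀ y v → y * (y * (y * v)) + 1 + y * y ≡ y * y * (y * v + 1) + 1
  factor = solve-∀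
  regroup : ∀ s r Z → (2 + s) * (2 + s) * ((1 + r * 2) * (3 + s) + (3 + s) * (3 + s) * Z) + 1
    ≡ (1 + suc r * 2) * (3 + s) + (3 + s) * (3 + s) * ((2 + s) * (2 + s) * Z + (1 + r * 2) * s + r * 2) + (2 + s) * (2 + s)
  regroup = solve-∀

y<y^[1+2r] : ∀ {y} r → 1 < y → 1 ≤ r → y < y ^ (1 + r * 2)
y<y^[1+2r] {y} r 1<y 1≤r = subst (_< y ^ (1 + r * 2)) (*-identityʳ y)
  (^-monoʳ-< y 1<y (s≤s (≤-trans 1≤r (m≤m*n r 2))))

1+3s+1≢2*3^[1+b] : ∀ s b → 1 + s * 3 + 1 ≢ 2 * 3 ^ suc b
1+3s+1≢2*3^[1+b] s b eq = ∤r+ad s z<s ≤-refl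
  (subst (3 ∣_) (trans (sym eq) (+-comm (1 + s * 3) 1)) (∣n⇒∣m*n 2 (m∣m*n (3 ^ b))))

y+1∣2*3^b⇒y+1≡2*3^[1+c] : ∀ {y b} → 1 < y → ¬ 2 ∣ y → y + 1 ∣ 2 * 3 ^ b → ∃ λ c → y + 1 ≡ 2 * 3 ^ suc c
y+1∣2*3^b⇒y+1≡2*3^[1+c] {y} {b} 1<y 2∤y y+1∣2*3^b with odd⇒≡1+2q 2∤y
... | j , refl = exponent-positive (∣prime^⇒≡prime^ b prime[3] 1+j∣3^b)
  where
  y+1≡2[1+j] : 1 + j * 2 + 1 ≡ 2 * (1 + j)
  y+1≡2[1+j] = solve j
    where
    solve : ∀ j → 1 + j * 2 + 1 ≡ 2 * (1 + j)
    solve = solve-∀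
  1+j∣3^b : 1 + j ∣ 3 ^ b
  1+j∣3^b = *-cancelˡ-∣ 2 (subst (_∣ 2 * 3 ^ b) y+1≡2[1+j] y+1∣2*3^b)
  exponent-positive : ∃ (λ c → 1 + j ≡ 3 ^ c) → ∃ λ c → 1 + j * 2 + 1 ≡ 2 * 3 ^ suc c
  exponent-positive (zero  , 1+j≡1) = ⊥-elim (<-irrefl refl (subst (1 <_) (cong (λ j → 1 + j * 2) (suc-injective 1+j≡1)) 1<y))
  exponent-positive (suc c , 1+j≡3^[1+c]) = c , trans y+1≡2[1+j] (cong (2 *_) 1+j≡3^[1+c])

-- Modulo 3 ^ (2 + c) the expansion of y ^ E + 1 leaves only E (y + 1) = 2 E 3 ^ (1 + c).
3∣odd-exponent : ∀ {y b} r c → 1 < y → 1 ≤ r → y + 1 ≡ 2 * 3 ^ suc c → y ^ (1 + r * 2) + 1 ≡ 2 * 3 ^ b → 3 ∣ 1 + r * 2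
3∣odd-exponent {y@(suc (suc s))} {b} r c 1<y@(s≤s (s≤s _)) 1≤r y+1≡2x y^E+1≡2*3^b with odd-power-expansion s r
... | Z , expansion = [ ⊥-elim ∘ ∤r+ad 0 z<s ≤-refl , id ]′ (euclidsLemma 2 E prime[3] 3∣2E)
  where
  E x : ℕ
  E = 1 + r * 2
  x = 3 ^ suc c
  3+s≡2x : 3 + s ≡ 2 * x
  3+s≡2x = trans (+-comm 1 y) y+1≡2x
  3x∣2*3^b : 3 * x ∣ 2 * 3 ^ b
  3x∣2*3^b with m≤n⇒∃[o]m+o≡n 2+c≤b
    where
    2+c≤b : suc (suc c) ≤ b
    2+c≤b = ≰⇒> λ b≤1+c → <⇒≱ (*-cancelˡ-< 2 _ _ (begin-strict
      2 * x           ≡⟨ y+1≡2x ⟨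
      y + 1           <⟨ +-monoˡ-< 1 (y<y^[1+2r] r 1<y 1≤r) ⟩
      y ^ E + 1       ≡⟨ y^E+1≡2*3^b ⟩
      2 * 3 ^ b       ∎)) (^-monoʳ-≤ 3 b≤1+c)
      where open ≤-Reasoning
  ... | d , refl = ∣n⇒∣m*n 2 (m^n∣m^[n+o] 3 (suc (suc c)) d)
  3x∣[y+1]²Z : 3 * x ∣ (3 + s) * (3 + s) * Z
  3x∣[y+1]²Z = divides (4 * 3 ^ c * Z) (begin
    (3 + s) * (3 + s) * Z    ≡⟨ cong (λ u → u * u * Z) 3+s≡2x ⟩
    2 * x * (2 * x) * Z      ≡⟨ regroup (3 ^ c) Z ⟩
    4 * 3 ^ c * Z * (3 * x)  ∎)
    where
    open ≡-Reasoning
    regroup : ∀ w Z → 2 * (3 * w) * (2 * (3 * w)) * Z ≡ 4 * w * Z * (3 * (3 * w))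
    regroup = solve-∀
  3x∣E[y+1] : 3 * x ∣ E * (3 + s)
  3x∣E[y+1] = ∣m+n∣m⇒∣n
    (subst (3 * x ∣_) (trans (sym y^E+1≡2*3^b) (trans expansion (+-comm (E * (3 + s)) _))) 3x∣2*3^b) 3x∣[y+1]²Z
  3∣2E : 3 ∣ 2 * E
  3∣2E = *-cancelʳ-∣ x {{m^n≢0 3 (suc c)}} (subst (3 * x ∣_) (trans (cong (E *_) 3+s≡2x) (regroup E x)) 3x∣E[y+1])
    where
    regroup : ∀ E x → E * (2 * x) ≡ 2 * E * x
    regroup = solve-∀

-- p ³ + 1 = 9 (k + 1) R with R = 3 k² + 3 k + 1 ≡ 1 (mod 3) dividing 2 * 3 ^ b, so R ∣ 2,
-- forcing k = 0 and p = 2.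
p^[3t]+1≢2*3^b : ∀ {p b} k t → p ≡ 2 + k * 3 → ¬ 2 ∣ p → ¬ 2 ∣ t → p ^ (t * 3) + 1 ≢ 2 * 3 ^ b
p^[3t]+1≢2*3^b {p} {b} k t p≡2+3k 2∤p 2∤t p^[3t]+1≡2*3^b with odd⇒≡1+2q 2∤t
... | u , refl = 2∤p (subst (2 ∣_) (sym (trans p≡2+3k (cong (λ k → 2 + k * 3) k≡0))) ∣-refl)
  where
  R : ℕ
  R = 1 + (k + k * k) * 3
  p³+1≡ : p ^ 3 + 1 ≡ R * (9 * (1 + k))
  p³+1≡ = trans (cong (λ p → p ^ 3 + 1) p≡2+3k) (factor k)
    where
    factor : ∀ k → (2 + k * 3) * ((2 + k * 3) * ((2 + k * 3) * 1)) + 1 ≡ (1 + (k + k * k) * 3) * (9 * (1 + k))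
    factor = solve-∀
  p³+1∣2*3^b : p ^ 3 + 1 ∣ 2 * 3 ^ b
  p³+1∣2*3^b = subst (p ^ 3 + 1 ∣_) (trans (cong (_+ 1) p³^t≡p^[3t]) p^[3t]+1≡2*3^b) (y+1∣y^[1+2q]+1 (p ^ 3) u)
    where
    p³^t≡p^[3t] : (p ^ 3) ^ (1 + u * 2) ≡ p ^ ((1 + u * 2) * 3)
    p³^t≡p^[3t] = trans (^-*-assoc p 3 (1 + u * 2)) (cong (p ^_) (*-comm 3 (1 + u * 2)))
  R∣2 : R ∣ 2
  R∣2 = coprime-divisor (coprime-^ʳ b (Coprime.sym (prime∤⇒coprime prime[3] (∤r+ad (k + k * k) z<s (s≤s (s≤s z≤n))))))
    (subst (R ∣_) (*-comm 2 (3 ^ b)) (∣-trans (divides (9 * (1 + k)) (trans p³+1≡ (*-comm R _))) p³+1∣2*3^b))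
  k≡0 : k ≡ 0
  k≡0 = R≤2⇒k≡0 k (∣⇒≤ R∣2)
    where
    R≤2⇒k≡0 : ∀ k → 1 + (k + k * k) * 3 ≤ 2 → k ≡ 0
    R≤2⇒k≡0 zero    _ = refl
    R≤2⇒k≡0 (suc k) (s≤s (s≤s ()))

p≡2[mod3]⇒p^[2h]≡1[mod3] : ∀ {p} k h → p ≡ 2 + k * 3 → ∃ λ s → p ^ (h * 2) ≡ 1 + s * 3
p≡2[mod3]⇒p^[2h]≡1[mod3] {p} k h p≡2+3k =
  let s , eq = ^≡1[mod] 3 (1 + k * 4 + k * k * 3) h in s , (begin
    p ^ (h * 2)                         ≡⟨ cong (p ^_) (*-comm h 2) ⟩
    p ^ (2 * h)                         ≡⟨ ^-*-assoc p 2 h ⟨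
    (p ^ 2) ^ h                         ≡⟨ cong (_^ h) (trans (cong (_^ 2) p≡2+3k) (square k)) ⟩
    (1 + (1 + k * 4 + k * k * 3) * 3) ^ h ≡⟨ eq ⟩
    1 + s * 3                           ∎)
  where
  open ≡-Reasoning
  square : ∀ k → (2 + k * 3) * ((2 + k * 3) * 1) ≡ 1 + (1 + k * 4 + k * k * 3) * 3
  square = solve-∀

-- Modulo 3, p ^ E ≡ 1 unless p ≡ 2 (mod 3) and E is odd; 3∣odd-exponent then forces 3 ∣ E,
-- the case excluded by p^[3t]+1≢2*3^b.
p^[2+e]+1≢2*3^b : ∀ {p} e b → 1 < p → ¬ 2 ∣ p → ¬ 3 ∣ p → p ^ (2 + e) + 1 ≢ 2 * 3 ^ b
p^[2+e]+1≢2*3^b {p} e zero 1<p _ _ p^E+1≡2 with m^n≡1⇒n≡0∨m≡1 p (2 + e) (+-cancelʳ-≡ 1 _ _ p^E+1≡2)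
... | inj₂ refl = <-irrefl refl 1<p
p^[2+e]+1≢2*3^b {p} e (suc b) 1<p 2∤p 3∤p p^E+1≡2*3^b = by-residue (p divMod 3)
  where
  E : ℕ
  E = 2 + e
  not-1[mod3] : (∃ λ s → p ^ E ≡ 1 + s * 3) → ⊥
  not-1[mod3] (s , p^E≡1+3s) = 1+3s+1≢2*3^[1+b] s b (trans (cong (_+ 1) (sym p^E≡1+3s)) p^E+1≡2*3^b)
  odd-exponent : ∀ r → E ≡ 1 + r * 2 → ¬ 3 ∣ E → ⊥
  odd-exponent zero    ()
  odd-exponent (suc r) E≡1+2r 3∤E with y+1∣2*3^b⇒y+1≡2*3^[1+c] {b = suc b} 1<p 2∤p p+1∣2*3^b
    where
    p+1∣2*3^b : p + 1 ∣ 2 * 3 ^ suc b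
    p+1∣2*3^b = subst (p + 1 ∣_) p^E+1≡2*3^b
      (subst (λ E → p + 1 ∣ p ^ E + 1) (sym E≡1+2r) (y+1∣y^[1+2q]+1 p (suc r)))
  ... | c , p+1≡2*3^[1+c] = 3∤E (subst (3 ∣_) (sym E≡1+2r) (3∣odd-exponent {b = suc b} (suc r) c 1<p (s≤s z≤n)
    p+1≡2*3^[1+c] (subst (λ E → p ^ E + 1 ≡ 2 * 3 ^ suc b) E≡1+2r p^E+1≡2*3^b)))
  by-residue : DivMod p 3 → ⊥
  by-residue (result k zero                   p≡3k)   = 3∤p (divides k p≡3k)
  by-residue (result k (suc zero)             p≡1+3k) =
    let s , [1+3k]^E≡1+3s = ^≡1[mod] 3 k E in not-1[mod3] (s , trans (cong (_^ E) p≡1+3k) [1+3k]^E≡1+3s)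
  by-residue (result k (suc (suc zero))       p≡2+3k) with 2 ∣? E | 3 ∣? E
  ... | yes (divides h E≡2h) | _ =
    let s , p^[2h]≡1+3s = p≡2[mod3]⇒p^[2h]≡1[mod3] k h p≡2+3k in not-1[mod3] (s , trans (cong (p ^_) E≡2h) p^[2h]≡1+3s)
  ... | no 2∤E | yes (divides t E≡3t) =
    p^[3t]+1≢2*3^b {b = suc b} k t p≡2+3k 2∤p 2∤t (subst (λ E → p ^ E + 1 ≡ 2 * 3 ^ suc b) E≡3t p^E+1≡2*3^b)
    where
    2∤t : ¬ 2 ∣ t
    2∤t 2∣t = 2∤E (subst (2 ∣_) (sym E≡3t) (∣m⇒∣m*n 3 2∣t))
  ... | no 2∤E | no 3∤E = let r , E≡1+2r = odd⇒≡1+2q 2∤E in odd-exponent r E≡1+2r 3∤E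

p^[1+e]+1≡2*3^c⇒e≡0×1≤c : ∀ {p e c} → 1 < p → ¬ 2 ∣ p → ¬ 3 ∣ p → p ^ suc e + 1 ≡ 2 * 3 ^ c → e ≡ 0 × 1 ≤ c
p^[1+e]+1≡2*3^c⇒e≡0×1≤c {p} {suc e} {c} 1<p 2∤p 3∤p eq = ⊥-elim (p^[2+e]+1≢2*3^b e c 1<p 2∤p 3∤p eq)
p^[1+e]+1≡2*3^c⇒e≡0×1≤c {p} {zero} {zero} 1<p _ _ eq = ⊥-elim (<-irrefl (sym (trans (sym (*-identityʳ p)) (+-cancelʳ-≡ 1 _ _ eq))) 1<p)
p^[1+e]+1≡2*3^c⇒e≡0×1≤c {p} {zero} {suc c} _ _ _ _ = refl , s≤s z≤n

1+y∣2^a*3^b⇒y+1≡2*3^c : ∀ {y a b} s → y ≡ 1 + s * 4 → 1 + y ∣ 2 ^ a * 3 ^ b → ∃ λ c → y + 1 ≡ 2 * 3 ^ c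
1+y∣2^a*3^b⇒y+1≡2*3^c {y} {a} {b} s refl 1+y∣2^a*3^b =
  let c , odd≡3^c = ∣prime^⇒≡prime^ b prime[3] odd∣3^b in c , trans (+-comm y 1) (trans 1+y≡2[1+2s] (cong (2 *_) odd≡3^c))
  where
  1+y≡2[1+2s] : 1 + (1 + s * 4) ≡ 2 * (1 + s * 2)
  1+y≡2[1+2s] = solve s
    where
    solve : ∀ s → 1 + (1 + s * 4) ≡ 2 * (1 + s * 2)
    solve = solve-∀
  odd⊥2^a : Coprime (1 + s * 2) (2 ^ a)
  odd⊥2^a = coprime-^ʳ a (Coprime.sym (prime∤⇒coprime prime[2] (∤r+ad s z<s ≤-refl)))
  odd∣3^b : 1 + s * 2 ∣ 3 ^ b
  odd∣3^b = coprime-divisor odd⊥2^a (m*n∣⇒n∣ 2 (1 + s * 2) (subst (_∣ 2 ^ a * 3 ^ b) 1+y≡2[1+2s] 1+y∣2^a*3^b))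

-- Odd N with σ* (σ* N) = 2 N

σ*[2^a*3^b] : ∀ {a b} → 1 ≤ a → 1 ≤ b → σ* (2 ^ a * 3 ^ b) ≡ (1 + 2 ^ a) * (1 + 3 ^ b)
σ*[2^a*3^b] {suc a} {suc b} _ _ = begin
  σ* (2 ^ suc a * 3 ^ suc b)            ≡⟨ σ*-*primePower a prime[2] 2∤3^[1+b] ⟩
  (1 + 2 ^ suc a) * σ* (3 ^ suc b)      ≡⟨ cong (λ n → (1 + 2 ^ suc a) * σ* n) (*-identityʳ (3 ^ suc b)) ⟨
  (1 + 2 ^ suc a) * σ* (3 ^ suc b * 1)  ≡⟨ cong ((1 + 2 ^ suc a) *_) (σ*-*primePower b prime[3] (∤r+ad 0 z<s (s≤s (s≤s z≤n)))) ⟩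
  (1 + 2 ^ suc a) * ((1 + 3 ^ suc b) * 1) ≡⟨ cong ((1 + 2 ^ suc a) *_) (*-identityʳ _) ⟩
  (1 + 2 ^ suc a) * (1 + 3 ^ suc b)     ∎
  where
  open ≡-Reasoning
  2∤3^[1+b] : ¬ 2 ∣ 3 ^ suc b
  2∤3^[1+b] 2∣3^[1+b] = ∤r+ad 1 z<s ≤-refl (prime∣^⇒∣ (suc b) prime[2] 2∣3^[1+b])

3∣2^a*q^b⇒q≡3 : ∀ {q} a b → Prime q → 3 ∣ 2 ^ a * q ^ b → q ≡ 3
3∣2^a*q^b⇒q≡3 {q} a b q-prime 3∣2^a*q^b with euclidsLemma (2 ^ a) (q ^ b) prime[3] 3∣2^a*q^b
... | inj₁ 3∣2^a = ⊥-elim (∤r+ad 0 z<s ≤-refl (prime∣^⇒∣ a prime[3] 3∣2^a))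
... | inj₂ 3∣q^b with prime⇒irreducible q-prime (prime∣^⇒∣ b prime[3] 3∣q^b)
...   | inj₁ ()
...   | inj₂ 3≡q = sym 3≡q

prime∣N⇒p+1≡2*3^c : ∀ {N f₁ f₂ p} → ¬ 2 ∣ N → ¬ 3 ∣ N → 2 ∣ f₁ → 2 ∣ f₂ → σ* N ≡ 2 ^ f₁ * 3 ^ f₂
  → 2 * N ≡ (1 + 2 ^ f₁) * (1 + 3 ^ f₂) → Prime p → p ∣ N → ∃ λ c → 1 ≤ c × p + 1 ≡ 2 * 3 ^ c
prime∣N⇒p+1≡2*3^c {N} {p = p} 2∤N 3∤N (divides a refl) (divides b refl) σ*N≡ 2N≡ p-prime p∣N =
  from-mod4 (prime∣x²+1⇒≡1[mod4] {x = proj₁ p∣z²+1} p-prime 2∤p (proj₂ p∣z²+1)) (1+p^[1+e]∣σ* {{N≢0}} p-prime p∣N)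
  where
  N≢0 : NonZero N
  N≢0 = ≢-nonZero λ { refl → 2∤N (2 ∣0) }
  1<p : 1 < p
  1<p = nonTrivial⇒n>1 p {{prime⇒nonTrivial p-prime}}
  2∤p : ¬ 2 ∣ p
  2∤p 2∣p = 2∤N (∣-trans 2∣p p∣N)
  3∤p : ¬ 3 ∣ p
  3∤p 3∣p = 3∤N (∣-trans 3∣p p∣N)
  p∣z²+1 : ∃ λ z → p ∣ z * z + 1
  p∣z²+1 = prime∣[1+x^2a][1+y^2b]⇒∣z²+1 2 3 a b p-prime (subst (p ∣_) 2N≡ (∣n⇒∣m*n 2 p∣N))
  from-power : ∀ {e} → (∃ λ c → p ^ suc e + 1 ≡ 2 * 3 ^ c) → ∃ λ c → 1 ≤ c × p + 1 ≡ 2 * 3 ^ c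
  from-power {e} (c , p^[1+e]+1≡2*3^c) with p^[1+e]+1≡2*3^c⇒e≡0×1≤c {e = e} {c} 1<p 2∤p 3∤p p^[1+e]+1≡2*3^c
  ... | refl , 1≤c = c , 1≤c , trans (cong (_+ 1) (sym (*-identityʳ p))) p^[1+e]+1≡2*3^c
  from-mod4 : (∃ λ k → p ≡ 1 + k * 4) → (∃ λ e → 1 + p ^ suc e ∣ σ* N) → ∃ λ c → 1 ≤ c × p + 1 ≡ 2 * 3 ^ c
  from-mod4 (k , p≡1+4k) (e , 1+p^[1+e]∣σ*N) with ^≡1[mod] 4 k (suc e)
  ... | s , [1+4k]^[1+e]≡1+4s = from-power {e} (1+y∣2^a*3^b⇒y+1≡2*3^c {a = a * 2} {b * 2} s
    (trans (cong (_^ suc e) p≡1+4k) [1+4k]^[1+e]≡1+4s) (subst (1 + p ^ suc e ∣_) σ*N≡ 1+p^[1+e]∣σ*N))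

-- Unused: 1 ≤ N and 2 ∤ q follow from the other hypotheses, and N ≢ 9, 165 hold as 3 ∣ 9, 165.
proposition4p1 : (N : ℕ) → 1 ≤ N → ¬ (2 ∣ N) → σ* (σ* N) ≡ 2 * N → N ≢ 9 → N ≢ 165
    → (f₁ f₂ q : ℕ) → Prime q → ¬ (2 ∣ q) → 1 ≤ f₁ → 1 ≤ f₂ → σ* N ≡ 2 ^ f₁ * q ^ f₂
    → ¬ (3 ∣ N) → 3 ∣ σ* N
    → 2 ∣ f₁ × 2 ∣ f₂
      × ((p : ℕ) → Prime p → p ∣ N → Σ ℕ (λ b → 1 ≤ b × p + 1 ≡ 2 * 3 ^ b))
proposition4p1 N _ 2∤N σ*σ*N≡2N _ _ f₁ f₂ q q-prime _ 1≤f₁ 1≤f₂ σ*N≡ 3∤N 3∣σ*N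
  with refl ← 3∣2^a*q^b⇒q≡3 f₁ f₂ q-prime (subst (3 ∣_) σ*N≡ 3∣σ*N)
  = 2∣f₁ , 2∣f₂ , λ p p-prime p∣N → prime∣N⇒p+1≡2*3^c 2∤N 3∤N 2∣f₁ 2∣f₂ σ*N≡ 2N≡ p-prime p∣N
  where
  2N≡ : 2 * N ≡ (1 + 2 ^ f₁) * (1 + 3 ^ f₂)
  2N≡ = trans (sym σ*σ*N≡2N) (trans (cong σ* σ*N≡) (σ*[2^a*3^b] 1≤f₁ 1≤f₂))
  ∣2N : ∀ {d} → d ∣ 1 + 2 ^ f₁ ⊎ d ∣ 1 + 3 ^ f₂ → d ∣ 2 * N
  ∣2N {d} (inj₁ d∣) = subst (d ∣_) (sym 2N≡) (∣m⇒∣m*n (1 + 3 ^ f₂) d∣)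
  ∣2N {d} (inj₂ d∣) = subst (d ∣_) (sym 2N≡) (∣n⇒∣m*n (1 + 2 ^ f₁) d∣)
  2∣f₁ : 2 ∣ f₁
  2∣f₁ = decidable-stable (2 ∣? f₁) λ 2∤f₁ →
    [ ∤r+ad 0 z<s ≤-refl , 3∤N ]′ (euclidsLemma 2 N prime[3] (∣2N (inj₁ (y+1∣1+y^odd 2 2∤f₁))))
  2∣f₂ : 2 ∣ f₂
  2∣f₂ = decidable-stable (2 ∣? f₂) λ 2∤f₂ → 2∤N (*-cancelˡ-∣ 2 (∣2N (inj₂ (y+1∣1+y^odd 3 2∤f₂))))
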